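{- Let $A$ be a set, $N\in\mathbb N$, $J\subseteq N$, and let $X,Y$ be double suits over ${}^NA$ with $X\le\Omega$ and $X\le Y$. Then $X+_JY=Y$.
   Context: Identify $N$ with $\{0,\dots,N-1\}$; ${}^NA$ is the set of valuations $\vec a=(a_0,\dots,a_{N-1})$; a team is a subset of ${}^NA$. For $J\subseteq N$, $\vec a\approx_J\vec b$ means they agree on $N\setminus J$. $V=V_1\cup_J V_2$ means $V_1\cup V_2=V$, $V_1\cap V_2=\emptyset$, and each $V_i$ is closed under $\approx_J$ within $V$. For pairs $X=\langle X^+,X^-\rangle$, $Y=\langle Y^+,Y^-\rangle$ of sets of teams, $X+_JY$ is the pair with $(X+_JY)^+=\{V:V=V_1\cup_JV_2$ for some $V_1\in X^+,V_2\in Y^+\}$ and $(X+_JY)^-=X^-\cap Y^-$. A suit is a nonempty set $S$ of teams such that $V'\subseteq V\in S$ implies $V'\in S$; a double suit is a pair $\langle X^+,X^-\rangle$ of suits with $X^+\cap X^-=\{\emptyset\}$. $\Omega=\langle\{\emptyset\},\{\emptyset\}\rangle$. For double suits, $X\le Y$ means $X^+\subseteq Y^+$ and $Y^-\subseteq X^-$. -}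

module Defs where

open import Data.Nat using (ℕ)
open import Data.Fin using (Fin)
open import Data.Fin.Subset using (Subset; _∉_)
open import Data.Product using (Σ; ∃; ∃-syntax; _×_; _,_)
open import Data.Sum using (_⊎_)
open import Data.Empty using (⊥)
open import Relation.Nullary using (¬_)
open import Relation.Binary.PropositionalEquality using (_≡_)
open import Function.Bundles using (_⇔_)

Valuation : Set → ℕ → Set
Valuation A N = Fin N → A

Team : Set → ℕ → Set₁
Team A N = Valuation A N → Set

TeamSet : Set → ℕ → Set₂
TeamSet A N = Team A N → Set₁

record Pair (A : Set) (N : ℕ) : Set₂ where
  constructor ⟨_,_⟩
  field
    pos : TeamSet A N
    neg : TeamSet A N
open Pair public

module _ {A : Set} {N : ℕ} where

  _⊆T_ : Team A N → Team A N → Set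
  V ⊆T W = ∀ a → V a → W a

  _≡T_ : Team A N → Team A N → Set
  V ≡T W = (V ⊆T W) × (W ⊆T V)

  -- the empty team (membership in {∅} is "is empty")
  IsEmptyTeam : Team A N → Set
  IsEmptyTeam V = ∀ a → ¬ V a

  _≈[_]_ : Valuation A N → Subset N → Valuation A N → Set
  a ≈[ J ] b = ∀ i → i ∉ J → a i ≡ b i

  ClosedWithin : Subset N → Team A N → Team A N → Set
  ClosedWithin J W V = ∀ a b → W a → V b → a ≈[ J ] b → W b

  SplitJ : Team A N → Subset N → Team A N → Team A N → Set
  SplitJ V J V₁ V₂ =
    (∀ a → V a ⇔ (V₁ a ⊎ V₂ a))
    × (∀ a → V₁ a → V₂ a → ⊥)
    × ClosedWithin J V₁ V × ClosedWithin J V₂ V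

  _+[_]_ : Pair A N → Subset N → Pair A N → Pair A N
  X +[ J ] Y = ⟨ (λ V → ∃[ V₁ ] ∃[ V₂ ] (pos X V₁ × pos Y V₂ × SplitJ V J V₁ V₂))
               , (λ V → neg X V × neg Y V) ⟩

  IsSuit : TeamSet A N → Set₁
  IsSuit S = (∃[ V ] S V) × (∀ V V′ → V′ ⊆T V → S V → S V′)

  IsDoubleSuit : Pair A N → Set₁
  IsDoubleSuit X = IsSuit (pos X) × IsSuit (neg X)
                 × (∀ V → (pos X V × neg X V) ⇔ Lift₁ (IsEmptyTeam V))
    where
    open import Level using (Lift)
    Lift₁ : Set → Set₁
    Lift₁ P = Lift _ P

  Ω : Pair A N
  Ω = ⟨ (λ V → Lift₁ (IsEmptyTeam V)) , (λ V → Lift₁ (IsEmptyTeam V)) ⟩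
    where
    open import Level using (Lift)
    Lift₁ : Set → Set₁
    Lift₁ P = Lift _ P

  _≤D_ : Pair A N → Pair A N → Set₁
  X ≤D Y = (∀ V → pos X V → pos Y V) × (∀ V → neg Y V → neg X V)

  _≐_ : Pair A N → Pair A N → Set₁
  X ≐ Y = (∀ V → pos X V ⇔ pos Y V) × (∀ V → neg X V ⇔ neg Y V)

module Submission where

-- The hypothesis X ≤ Ω says that every team in X⁺ is empty, and
-- since X⁺ is a suit it does contain the empty team.  So in X +_J Y the left
-- summand contributes nothing:
--   * if V = V₁ ∪_J V₂ with V₁ ∈ X⁺ and V₂ ∈ Y⁺, then V₁ = ∅ forces V ⊆ V₂,
--     hence V ∈ Y⁺ by downward closure of the suit Y⁺;
--   * conversely every V ∈ Y⁺ splits trivially as V = ∅ ∪_J V with ∅ ∈ X⁺.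
-- For the negative parts, X ≤ Y gives Y⁻ ⊆ X⁻, so X⁻ ∩ Y⁻ = Y⁻.

open import Defs
open import Data.Nat using (ℕ)
open import Data.Fin.Subset using (Subset)
open import Data.Product using (∃-syntax; _×_; _,_; proj₂)
open import Data.Sum using (inj₁; inj₂; [_,_])
open import Data.Empty using (⊥; ⊥-elim)
open import Function.Bundles using (mk⇔; Equivalence)
open import Level using (lower)

module _ {A : Set} {N : ℕ} where

  ∅T : Team A N
  ∅T _ = ⊥

  suit-contains-∅ : {S : TeamSet A N} → IsSuit S → S ∅T
  suit-contains-∅ ((W , W∈S) , downward) = downward W ∅T (λ _ ()) W∈S

  split-∅-left : (V : Team A N) (J : Subset N) → SplitJ V J ∅T V
  split-∅-left V J =
      (λ a → mk⇔ inj₂ [ (λ ()) , (λ v → v) ])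
    , (λ _ ())
    , (λ _ _ ())
    , (λ _ _ _ vb _ → vb)

  split-empty-left-⊆ : {V V₁ V₂ : Team A N} {J : Subset N}
    → SplitJ V J V₁ V₂ → IsEmptyTeam V₁ → V ⊆T V₂
  split-empty-left-⊆ (V⇔V₁⊎V₂ , _ , _ , _) V₁-empty a va =
    [ (λ v₁ → ⊥-elim (V₁-empty a v₁)) , (λ v₂ → v₂) ]
      (Equivalence.to (V⇔V₁⊎V₂ a) va)

  below-Ω-pos-empty : {X : Pair A N} → X ≤D Ω → ∀ V → pos X V → IsEmptyTeam V
  below-Ω-pos-empty (X⁺⊆Ω⁺ , _) V V∈X⁺ = lower (X⁺⊆Ω⁺ V V∈X⁺)

  sum-pos-absorbs : (J : Subset N) (X Y : Pair A N)
    → IsSuit (pos Y)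
    → (∀ V → pos X V → IsEmptyTeam V)
    → ∀ V → pos (X +[ J ] Y) V → pos Y V
  sum-pos-absorbs J X Y (_ , Y⁺-downward) X⁺-empty V
                  (V₁ , V₂ , V₁∈X⁺ , V₂∈Y⁺ , split) =
    Y⁺-downward V₂ V (split-empty-left-⊆ split (X⁺-empty V₁ V₁∈X⁺)) V₂∈Y⁺

  sum-pos-contains : (J : Subset N) (X Y : Pair A N)
    → IsSuit (pos X) → ∀ V → pos Y V → pos (X +[ J ] Y) V
  sum-pos-contains J X Y X⁺-suit V V∈Y⁺ =
    ∅T , V , suit-contains-∅ X⁺-suit , V∈Y⁺ , split-∅-left V J

  sum-neg-absorbs : (J : Subset N) (X Y : Pair A N)
    → (∀ V → neg Y V → neg X V)
    → ∀ V → neg Y V → neg (X +[ J ] Y) V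
  sum-neg-absorbs J X Y Y⁻⊆X⁻ V V∈Y⁻ = Y⁻⊆X⁻ V V∈Y⁻ , V∈Y⁻

mainTheorem10 : (A : Set) (N : ℕ) (J : Subset N) (X Y : Pair A N)
    → IsDoubleSuit X → IsDoubleSuit Y
    → X ≤D Ω → X ≤D Y
    → (X +[ J ] Y) ≐ Y
mainTheorem10 A N J X Y (X⁺-suit , _ , _) (Y⁺-suit , _ , _) X≤Ω (_ , Y⁻⊆X⁻) =
    (λ V → mk⇔ (sum-pos-absorbs J X Y Y⁺-suit X⁺-empty V)
               (sum-pos-contains J X Y X⁺-suit V))
  , (λ V → mk⇔ proj₂ (sum-neg-absorbs J X Y Y⁻⊆X⁻ V))
  where
  X⁺-empty : ∀ V → pos X V → IsEmptyTeam V
  X⁺-empty = below-Ω-pos-empty X≤Ω
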